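{- Let $\Psi$ and $\Phi$ be ensembles. Then $\prod\Phi$ is a subspace of $\prod\Psi$ if and only if $\Phi\subseteq\Psi$.
   Context: An ensemble is a mapping $\Psi$ (a set of ordered pairs $(i,\Psi(i))$) with non-empty domain $\operatorname{dom}\Psi$ whose values are non-empty sets; $\Phi\subseteq\Psi$ means inclusion as sets of ordered pairs. A choice of $\Psi$ is a mapping $\chi$ on $\operatorname{dom}\Psi$ with $\chi(i)\in\Psi(i)$ for all $i$; $\prod\Psi$ is the set of all choices. A set $X$ is a subspace of $\prod\Psi$ if there exists $R\subseteq\operatorname{dom}\Psi$ with $X=\{\chi|_R:\chi\in\prod\Psi\}$. -}

module Defs where

open import Level using (0ℓ)
open import Data.Product using (Σ; ∃; _×_; _,_)
open import Relation.Binary.PropositionalEquality using (_≡_)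
open import Function.Bundles using (_⇔_)

record Ensemble (I A : Set) : Set₁ where
  field
    dom          : I → Set
    val          : I → A → Set
    dom-nonempty : ∃ dom
    val-nonempty : ∀ i → dom i → ∃ (val i)
open Ensemble public

Graph : Set → Set → Set₁
Graph I A = I → A → Set

_≐_ : ∀ {I A} → Graph I A → Graph I A → Set
f ≐ g = ∀ i a → (f i a → g i a) × (g i a → f i a)

record IsChoice {I A : Set} (Ψ : Ensemble I A) (χ : Graph I A) : Set where
  field
    in-dom     : ∀ i a → χ i a → dom Ψ i
    total      : ∀ i → dom Ψ i → ∃ (χ i)
    functional : ∀ i a b → χ i a → χ i b → a ≡ b
    in-val     : ∀ i a → χ i a → val Ψ i a

∏ : ∀ {I A} → Ensemble I A → Graph I A → Set
∏ Ψ χ = IsChoice Ψ χ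

_∣_ : ∀ {I A} → Graph I A → (I → Set) → Graph I A
(χ ∣ R) i a = R i × χ i a

IsSubspace : ∀ {I A} → (Graph I A → Set) → Ensemble I A → Set₁
IsSubspace {I} {A} X Ψ =
  Σ (I → Set) λ R →
    (∀ i → R i → dom Ψ i) ×
    (∀ (f : Graph I A) → X f ⇔ (Σ (Graph I A) λ χ → ∏ Ψ χ × (f ≐ (χ ∣ R))))

-- Φ ⊆ Ψ as sets of ordered pairs (i , Φ(i)).
_⊆ᴱ_ : ∀ {I A} → Ensemble I A → Ensemble I A → Set
Φ ⊆ᴱ Ψ = ∀ i → dom Φ i → dom Ψ i × (∀ a → val Φ i a ⇔ val Ψ i a)

-- If Φ ⊆ Ψ, a choice of Φ extends to a choice of Ψ by overriding an arbitrary choice of Ψ on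
-- dom Φ, so ∏ Φ is the restriction of ∏ Ψ to R = dom Φ. Conversely, suppose ∏ Φ = {χ|_R : χ ∈ ∏ Ψ}.
-- Overriding a choice at a single index i by any allowed value a keeps it a choice. Applied to a
-- choice of Φ this gives i ∈ R ⊆ dom Ψ and Φ(i) ⊆ Ψ(i); applied to a choice of Ψ, which then
-- restricts to a choice of Φ, it gives Ψ(i) ⊆ Φ(i). Excluded middle decides the case distinctions
-- (i ∈ dom, i ∈ R) that these constructions need.
module Submission where

open import Defs
open import Level using (0ℓ)
open import Axiom.ExcludedMiddle using (ExcludedMiddle)
open import Function.Base using (id)
open import Function.Bundles using (_⇔_; mk⇔; Equivalence)
open import Data.Product using (Σ; ∃; _×_; _,_; proj₁; proj₂)
open import Data.Sum using (_⊎_; inj₁; inj₂)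
open import Data.Empty using (⊥)
open import Relation.Nullary using (¬_; Dec; yes; no; contradiction)
open import Relation.Binary.PropositionalEquality using (_≡_; refl; sym; trans; subst)

open IsChoice
open Equivalence using (to; from)

private
  variable
    I A : Set
    E Ψ Φ : Ensemble I A
    χ f g : Graph I A
    R : I → Set

≐-refl : f ≐ f
≐-refl i a = id , id

∏-resp-≐ : f ≐ g → ∏ E g → ∏ E f
∏-resp-≐ f≐g cg = record
  { in-dom     = λ i a fia → in-dom cg i a (proj₁ (f≐g i a) fia)
  ; total      = λ i d → let (a , gia) = total cg i d in a , proj₂ (f≐g i a) gia
  ; functional = λ i a b fia fib → functional cg i a b (proj₁ (f≐g i a) fia) (proj₁ (f≐g i b) fib)
  ; in-val     = λ i a fia → in-val cg i a (proj₁ (f≐g i a) fia)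
  }

restrict-∏ : Φ ⊆ᴱ Ψ → ∏ Ψ χ → ∏ Φ (χ ∣ dom Φ)
restrict-∏ Φ⊆Ψ cχ = record
  { in-dom     = λ i a (d , _) → d
  ; total      = λ i d → let (a , χia) = total cχ i (proj₁ (Φ⊆Ψ i d)) in a , d , χia
  ; functional = λ i a b (_ , χia) (_ , χib) → functional cχ i a b χia χib
  ; in-val     = λ i a (d , χia) → from (proj₂ (Φ⊆Ψ i d) a) (in-val cχ i a χia)
  }

override : (I → Set) → Graph I A → Graph I A → Graph I A
override R f g i a = (R i × f i a) ⊎ (¬ R i × g i a)

SelectsOn : Ensemble I A → (I → Set) → Graph I A → Set
SelectsOn {A = A} E R f = ∀ i → R i → dom E i × Σ A λ a → val E i a × (∀ b → f i b ⇔ b ≡ a)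

override-restrict : (∀ i a → f i a → R i) → f ≐ (override R f g ∣ R)
override-restrict {f = f} {R = R} {g = g} f⊆R i a =
  (λ fia → f⊆R i a fia , inj₁ (f⊆R i a fia , fia)) , back
  where
  back : (override R f g ∣ R) i a → f i a
  back (_ , inj₁ (_ , fia)) = fia
  back (r , inj₂ (¬r , _))  = contradiction r ¬r

update : Graph I A → I → A → Graph I A
update χ i a = override (_≡ i) (λ _ b → b ≡ a) χ

update-at : ∀ {i a} → update χ i a i a
update-at = inj₁ (refl , refl)

∏-selectsOn-dom : Φ ⊆ᴱ Ψ → ∏ Φ f → SelectsOn Ψ (dom Φ) f
∏-selectsOn-dom Φ⊆Ψ cf i d =
  let (a , fia) = total cf i d
  in proj₁ (Φ⊆Ψ i d) , a , to (proj₂ (Φ⊆Ψ i d) a) (in-val cf i a fia) ,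
     λ b → mk⇔ (λ fib → functional cf i b a fib fia) (λ { refl → fia })

default : (E : Ensemble I A) (i : I) → Dec (dom E i) → A → Set
default E i (yes d) a = a ≡ proj₁ (val-nonempty E i d)
default E i (no _)  a = ⊥

module _ (em : ExcludedMiddle 0ℓ) where

  ∏-nonempty : (E : Ensemble I A) → ∃ (∏ E)
  ∏-nonempty E = (λ i → default E i em) , record
    { in-dom     = λ i a → default-in-dom i em
    ; total      = λ i → default-total i em
    ; functional = λ i a b → default-functional i em
    ; in-val     = λ i a → default-in-val i em
    }
    where
    default-in-dom : ∀ {a} i (p : Dec (dom E i)) → default E i p a → dom E i
    default-in-dom i (yes d) _ = d

    default-total : ∀ i (p : Dec (dom E i)) → dom E i → ∃ (default E i p)
    default-total i (yes d) _  = proj₁ (val-nonempty E i d) , refl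
    default-total i (no ¬d) d = contradiction d ¬d

    default-functional : ∀ {a b} i (p : Dec (dom E i)) → default E i p a → default E i p b → a ≡ b
    default-functional i (yes _) a≡ b≡ = trans a≡ (sym b≡)

    default-in-val : ∀ {a} i (p : Dec (dom E i)) → default E i p a → val E i a
    default-in-val i (yes d) refl = proj₂ (val-nonempty E i d)

  override-∏ : SelectsOn E R f → ∏ E g → ∏ E (override R f g)
  override-∏ {E = E} {R = R} {f = f} {g = g} sel cg = record
    { in-dom     = in-dom′
    ; total      = total′
    ; functional = functional′
    ; in-val     = in-val′
    }
    where
    in-dom′ : ∀ i a → override R f g i a → dom E i
    in-dom′ i a (inj₁ (r , _))   = proj₁ (sel i r)
    in-dom′ i a (inj₂ (_ , gia)) = in-dom cg i a gia

    total′ : ∀ i → dom E i → ∃ (override R f g i)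
    total′ i d with em {R i}
    ... | yes r = let (a , _ , f≡a) = proj₂ (sel i r) in a , inj₁ (r , from (f≡a a) refl)
    ... | no ¬r = let (a , gia) = total cg i d in a , inj₂ (¬r , gia)

    functional′ : ∀ i a b → override R f g i a → override R f g i b → a ≡ b
    functional′ i a b (inj₁ (r , fia)) (inj₁ (_ , fib)) =
      let (_ , _ , f≡c) = proj₂ (sel i r) in trans (to (f≡c a) fia) (sym (to (f≡c b) fib))
    functional′ i a b (inj₁ (r , _))   (inj₂ (¬r , _))  = contradiction r ¬r
    functional′ i a b (inj₂ (¬r , _))  (inj₁ (r , _))   = contradiction r ¬r
    functional′ i a b (inj₂ (_ , gia)) (inj₂ (_ , gib)) = functional cg i a b gia gib

    in-val′ : ∀ i a → override R f g i a → val E i a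
    in-val′ i a (inj₁ (r , fia)) =
      let (_ , c , vc , f≡c) = sel i r in subst (val E i) (sym (to (f≡c a) fia)) vc
    in-val′ i a (inj₂ (_ , gia)) = in-val cg i a gia

  update-∏ : ∀ {i a} → dom E i → val E i a → ∏ E χ → ∏ E (update χ i a)
  update-∏ d v = override-∏ λ { j refl → d , _ , v , λ b → mk⇔ id id }

  ⊆ᴱ⇒subspace : Φ ⊆ᴱ Ψ → IsSubspace (∏ Φ) Ψ
  ⊆ᴱ⇒subspace {Φ = Φ} {Ψ = Ψ} Φ⊆Ψ =
    dom Φ , (λ i d → proj₁ (Φ⊆Ψ i d)) ,
    λ f → mk⇔ extend (λ (χ , cχ , f≐) → ∏-resp-≐ f≐ (restrict-∏ Φ⊆Ψ cχ))
    where
    extend : ∏ Φ f → Σ (Graph _ _) λ χ → ∏ Ψ χ × (f ≐ (χ ∣ dom Φ))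
    extend {f} cf =
      let (χ₀ , cχ₀) = ∏-nonempty Ψ
      in override (dom Φ) f χ₀ ,
         override-∏ {R = dom Φ} {f = f} (∏-selectsOn-dom {Ψ = Ψ} Φ⊆Ψ cf) cχ₀ ,
         override-restrict (in-dom cf)

  subspace⇒⊆ᴱ : IsSubspace (∏ Φ) Ψ → Φ ⊆ᴱ Ψ
  subspace⇒⊆ᴱ {Φ = Φ} {Ψ = Ψ} (R , R⊆dom , ∏Φ≡) i d = R⊆dom i Ri , λ a → mk⇔ (val⊆ a) (val⊇ a)
    where
    restricted : ∏ Φ f → ∀ {j b} → f j b → R j × val Ψ j b
    restricted cf {j} {b} fjb =
      let (χ , cχ , f≐) = to (∏Φ≡ _) cf
          (r , χjb) = proj₁ (f≐ j b) fjb
      in r , in-val cχ j b χjb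

    updated : ∀ a → val Φ i a → R i × val Ψ i a
    updated a v =
      let (f₀ , cf₀) = ∏-nonempty Φ
      in restricted (update-∏ {χ = f₀} d v cf₀) (update-at {χ = f₀})

    Ri : R i
    Ri = proj₁ (updated _ (proj₂ (val-nonempty Φ i d)))

    val⊆ : ∀ a → val Φ i a → val Ψ i a
    val⊆ a v = proj₂ (updated a v)

    val⊇ : ∀ a → val Ψ i a → val Φ i a
    val⊇ a v =
      let (χ₀ , cχ₀) = ∏-nonempty Ψ
          cχ = update-∏ (R⊆dom i Ri) v cχ₀
      in in-val (from (∏Φ≡ _) (update χ₀ i a , cχ , ≐-refl)) i a (Ri , update-at {χ = χ₀})

theoremA3p21 : ExcludedMiddle 0ℓ → {I A : Set} (Ψ Φ : Ensemble I A) →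
    IsSubspace (∏ Φ) Ψ ⇔ (Φ ⊆ᴱ Ψ)
theoremA3p21 em Ψ Φ = mk⇔ (subspace⇒⊆ᴱ em) (⊆ᴱ⇒subspace em)
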